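{- (Chop Lemma – Bottom.) Let $r$ and $c$ be typical sequences of length $m\ge 3$ and $n\ge 3$, respectively, and let $M$ be their merge matrix. Suppose $r(m)=\min(r)$ and $c(n)=\min(c)$. Let $M_1=M[1..(m-2),1..n]$ and $M_2=M[1..m,1..(n-2)]$, and for $h\in[2]$ let $p_h$ be a path in $M_h$ dominating every path in $M_h$. Let $p_1^+=p_1\circ (m-1,n),(m,n)$ and $p_2^+=p_2\circ(m,n-1),(m,n)$. (1) If $M[m-2,n-1]\le M[m-1,n-2]$, then $p_1^+$ dominates every path in $M$. (2) If $M[m-1,n-2]\le M[m-2,n-1]$, then $p_2^+$ dominates every path in $M$.
   Context: A typical sequence is an integer sequence $s$ equal to its own typical sequence $\tau(s)$, where $\tau(s)$ is obtained by exhaustively applying: (1) if $s(i)=s(i+1)$, delete $s(i+1)$; (2) if there are $i,j$ with $j-i\ge2$ such that $s(i)\le s(k)\le s(j)$ for all $i\le k\le j$ or $s(i)\ge s(k)\ge s(j)$ for all $i\le k\le j$, delete the elements strictly between positions $i$ and $j$. The merge matrix of $r$ and $c$ is the $m\times n$ matrix with $M[i,j]=r(i)+c(j)$; $M[a..b,c..d]$ denotes the submatrix on rows $a..b$, columns $c..d$, whose indices are identified with those of $M$. A path in a matrix with $m'$ rows and $n'$ columns is a sequence of indices starting at the bottom-left index and ending at the top-right index ($(1,1)$ and $(m',n')$ in its own indexing) where each step goes from $(i,j)$ to one of $(i+1,j),(i,j+1),(i+1,j+1)$; $M[p]$ is the sequence of entries along $p$. A path $p$ dominates a path $q$ if $M[p]$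 dominates $M[q]$, where for integer sequences $a$ dominates $b$ if there are extensions $a^*$ of $a$ and $b^*$ of $b$ of equal length with $a^*(k)\le b^*(k)$ for all $k$; an extension is obtained by repeating each element one or more times consecutively, preserving order. -}

module Defs where

open import Data.Nat using (ℕ; suc; _≤_; _<_; _+_)
open import Data.Integer as ℤ using (ℤ)
open import Data.Product using (_×_; _,_; ∃; ∃-syntax; Σ-syntax)
open import Data.Sum using (_⊎_)
open import Data.List using (List; []; _∷_; map)
open import Data.List.Relation.Binary.Pointwise using (Pointwise)
open import Relation.Binary.PropositionalEquality using (_≡_; _≢_)
open import Relation.Nullary using (¬_)

-- Integer sequences of length m are represented as functions ℕ → ℤ,
-- of which only the values at the (1-based) positions 1..m matter.
Seq : Set
Seq = ℕ → ℤ

BetweenUp : Seq → ℕ → ℕ → Set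
BetweenUp s i j = ∀ k → i ≤ k → k ≤ j → (s i ℤ.≤ s k) × (s k ℤ.≤ s j)

BetweenDown : Seq → ℕ → ℕ → Set
BetweenDown s i j = ∀ k → i ≤ k → k ≤ j → (s i ℤ.≥ s k) × (s k ℤ.≥ s j)

-- s (of length m) is typical: s = τ(s), i.e. neither reduction rule applies to s.
Typical : ℕ → Seq → Set
Typical m s =
  (∀ i → 1 ≤ i → i < m → s i ≢ s (suc i)) ×
  (∀ i j → 1 ≤ i → j ≤ m → 2 + i ≤ j → ¬ (BetweenUp s i j ⊎ BetweenDown s i j))

IsMinAt : ℕ → Seq → ℕ → Set
IsMinAt m s i = ∀ k → 1 ≤ k → k ≤ m → s i ℤ.≤ s k

merge : Seq → Seq → ℕ → ℕ → ℤ
merge r c i j = r i ℤ.+ c j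

Index : Set
Index = ℕ × ℕ

data Step : Index → Index → Set where
  up    : ∀ {i j} → Step (i , j) (suc i , j)
  right : ∀ {i j} → Step (i , j) (i , suc j)
  diag  : ∀ {i j} → Step (i , j) (suc i , suc j)

data Walk : Index → List Index → Index → Set where
  stop : ∀ {x} → Walk x (x ∷ []) x
  step : ∀ {x y z ps} → Step x y → Walk y ps z → Walk x (x ∷ ps) z

-- p is a path in the submatrix M[a..b, c..d] (indices identified with those of M)
IsPathIn : ℕ → ℕ → ℕ → ℕ → List Index → Set
IsPathIn a b c d p = Walk (a , c) p (b , d)

along : (ℕ → ℕ → ℤ) → List Index → List ℤ
along M p = map (λ { (i , j) → M i j }) p

data Ext {A : Set} : List A → List A → Set where
  []   : Ext [] []
  once : ∀ {x xs ys} → Ext xs ys → Ext (x ∷ xs) (x ∷ ys)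
  more : ∀ {x xs ys} → Ext (x ∷ xs) ys → Ext (x ∷ xs) (x ∷ ys)

Dominates : List ℤ → List ℤ → Set
Dominates a b = ∃[ a* ] ∃[ b* ] (Ext a a* × Ext b b* × Pointwise ℤ._≤_ a* b*)

PathDominates : (ℕ → ℕ → ℤ) → List Index → List Index → Set
PathDominates M p q = Dominates (along M p) (along M q)

-- Cut a path q of M where it leaves row m − 2, by a step (m − 2 , j) → (m − 1 , j₀), and
-- complete its first part along row m − 2 to a path of M₁, which p₁ dominates. A typical
-- sequence ending in its minimum has its maximum at the penultimate position and its minimum
-- over the remaining positions just before that; together with M[m−2,n−1] ≤ M[m−1,n−2] this
-- bounds every added entry of row m − 2 by M[m−1,j₀], so these entries can all be matched with
-- that single entry, which also dominates the appended M[m−1,n]. The rest of q lies above the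
-- global minimum M[m,n]. Part (2) is part (1) for the transposed matrix.
module Submission where

open import Defs
open import Data.Empty using (⊥-elim)
open import Function using (_∘_)
open import Data.Integer as ℤ using (ℤ)
import Data.Integer.Properties as ℤₚ
open import Data.List using (List; []; _∷_; _++_; map)
import Data.List.Properties as Listₚ
open import Data.List.Relation.Binary.Pointwise using (Pointwise; []; _∷_)
open import Data.List.Relation.Unary.All as All using (All; []; _∷_)
open import Data.List.Relation.Unary.All.Properties using (map⁺; ++⁻ʳ)
open import Data.Nat using (ℕ; zero; suc; _+_; _≤_; _<_; _∸_; z≤n; s≤s; _≤‴_; ≤‴-refl; ≤‴-step)
open import Data.Nat.Properties as ℕₚ
  using (≤-refl; ≤-trans; ≤-antisym; ≤-pred; n≤1+n; m≤n⇒m≤1+n; m<n⇒m<1+n; <⇒≱; ≰⇒>; <-cmp; m≤n⇒m<n∨m≡n; ≤⇒≤‴)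
open import Data.Product using (_×_; _,_; proj₁; proj₂; ∃-syntax)
import Data.Product as Product
open import Data.Sum using (inj₁; inj₂)
import Data.Sum as Sum
open import Relation.Binary.Definitions using (tri<; tri≈; tri>)
open import Relation.Binary.PropositionalEquality using (_≡_; refl; sym; trans; cong; cong₂; subst; subst₂)
open import Relation.Nullary using (yes; no)

private
  variable
    a b : List ℤ
    x y z : ℤ
    xs ys W : List ℤ

-- Domination, read off step by step: each move advances one or both lists,
-- and the current heads are comparable.
data Aligned : List ℤ → List ℤ → Set where
  []    : Aligned [] []
  both  : x ℤ.≤ y → Aligned xs ys → Aligned (x ∷ xs) (y ∷ ys)
  nextˡ : x ℤ.≤ y → Aligned xs (y ∷ ys) → Aligned (x ∷ xs) (y ∷ ys)
  nextʳ : x ℤ.≤ y → Aligned (x ∷ xs) ys → Aligned (x ∷ xs) (y ∷ ys)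

Aligned⇒Dominates : Aligned a b → Dominates a b
Aligned⇒Dominates [] = [] , [] , [] , [] , []
Aligned⇒Dominates (both x≤y al) with Aligned⇒Dominates al
... | _ , _ , ea , eb , pw = _ , _ , once ea , once eb , x≤y ∷ pw
Aligned⇒Dominates (nextˡ x≤y al) with Aligned⇒Dominates al
... | _ , _ , ea , eb , pw = _ , _ , once ea , more eb , x≤y ∷ pw
Aligned⇒Dominates (nextʳ x≤y al) with Aligned⇒Dominates al
... | _ , _ , ea , eb , pw = _ , _ , more ea , once eb , x≤y ∷ pw

Dominates⇒Aligned : Dominates a b → Aligned a b
Dominates⇒Aligned (_ , _ , ea , eb , pw) = aligned ea eb pw
  where
  aligned : ∀ {a b a* b*} → Ext a a* → Ext b b* → Pointwise ℤ._≤_ a* b* → Aligned a b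
  aligned [] [] [] = []
  aligned (once ea) (once eb) (x≤y ∷ pw) = both x≤y (aligned ea eb pw)
  aligned (once ea) (more eb) (x≤y ∷ pw) = nextˡ x≤y (aligned ea eb pw)
  aligned (more ea) (once eb) (x≤y ∷ pw) = nextʳ x≤y (aligned ea eb pw)
  aligned (more ea) (more eb) (_ ∷ pw) = aligned ea eb pw

absorb-bounded-suffix : ∀ b {a S x y} → Aligned a (b ++ S) → All (ℤ._≤ y) S → x ℤ.≤ y →
                        Aligned (a ++ x ∷ []) (b ++ y ∷ [])
absorb-bounded-suffix [] [] [] x≤y = both x≤y []
absorb-bounded-suffix [] (both u≤s al) (s≤y ∷ S≤y) x≤y =
  nextˡ (ℤₚ.≤-trans u≤s s≤y) (absorb-bounded-suffix [] al S≤y x≤y)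
absorb-bounded-suffix [] (nextˡ u≤s al) S≤y@(s≤y ∷ _) x≤y =
  nextˡ (ℤₚ.≤-trans u≤s s≤y) (absorb-bounded-suffix [] al S≤y x≤y)
absorb-bounded-suffix [] (nextʳ _ al) (_ ∷ S≤y) x≤y = absorb-bounded-suffix [] al S≤y x≤y
absorb-bounded-suffix (_ ∷ b) (both u≤v al) S≤y x≤y = both u≤v (absorb-bounded-suffix b al S≤y x≤y)
absorb-bounded-suffix (v ∷ b) (nextˡ u≤v al) S≤y x≤y = nextˡ u≤v (absorb-bounded-suffix (v ∷ b) al S≤y x≤y)
absorb-bounded-suffix (_ ∷ b) (nextʳ u≤v al) S≤y x≤y = nextʳ u≤v (absorb-bounded-suffix b al S≤y x≤y)

lower-bound-aligned : All (z ℤ.≤_) (y ∷ W) → Aligned (z ∷ []) (y ∷ W)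
lower-bound-aligned (z≤y ∷ []) = both z≤y []
lower-bound-aligned (z≤y ∷ z≤W@(_ ∷ _)) = nextʳ z≤y (lower-bound-aligned z≤W)

append-lower-bound : ∀ b {a y z W} → Aligned a (b ++ y ∷ []) → All (z ℤ.≤_) (y ∷ W) →
                     Aligned (a ++ z ∷ []) (b ++ y ∷ W)
append-lower-bound [] (both x≤y []) z≤ = nextˡ x≤y (lower-bound-aligned z≤)
append-lower-bound [] (nextˡ x≤y al) z≤ = nextˡ x≤y (append-lower-bound [] al z≤)
append-lower-bound (_ ∷ b) (both u≤v al) z≤ = both u≤v (append-lower-bound b al z≤)
append-lower-bound (v ∷ b) (nextˡ u≤v al) z≤ = nextˡ u≤v (append-lower-bound (v ∷ b) al z≤)
append-lower-bound (_ ∷ b) (nextʳ u≤v al) z≤ = nextʳ u≤v (append-lower-bound b al z≤)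

infix 4 _≼_
_≼_ : Index → Index → Set
(i , j) ≼ (i′ , j′) = i ≤ i′ × j ≤ j′

≼-refl : ∀ {u} → u ≼ u
≼-refl = ≤-refl , ≤-refl

≼-trans : ∀ {u v w} → u ≼ v → v ≼ w → u ≼ w
≼-trans (i≤i′ , j≤j′) (i′≤i″ , j′≤j″) = ≤-trans i≤i′ i′≤i″ , ≤-trans j≤j′ j′≤j″

step⇒≼ : ∀ {u v} → Step u v → u ≼ v
step⇒≼ up    = n≤1+n _ , ≤-refl
step⇒≼ right = ≤-refl , n≤1+n _
step⇒≼ diag  = n≤1+n _ , n≤1+n _

walk⇒≼ : ∀ {u p w} → Walk u p w → u ≼ w
walk⇒≼ stop        = ≼-refl
walk⇒≼ (step st w) = ≼-trans (step⇒≼ st) (walk⇒≼ w)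

walk-within : ∀ {u p w} → Walk u p w → All (λ v → u ≼ v × v ≼ w) p
walk-within stop        = (≼-refl , ≼-refl) ∷ []
walk-within (step st w) =
  (≼-refl , walk⇒≼ (step st w)) ∷ All.map (Product.map₁ (≼-trans (step⇒≼ st))) (walk-within w)

walk-++ : ∀ {u v w p s} → Walk u p v → Walk v (v ∷ s) w → Walk u (p ++ s) w
walk-++ stop         w = w
walk-++ (step st w₁) w = step st (walk-++ w₁ w)

rightwards : ∀ {i j d} → j ≤‴ d →
  ∃[ seg ] Walk (i , j) ((i , j) ∷ seg) (i , d) × All (λ v → (i , suc j) ≼ v × v ≼ (i , d)) seg
rightwards ≤‴-refl = [] , stop , []
rightwards (≤‴-step j<d) with rightwards j<d
... | _ , w , _ = _ , step right w , walk-within w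

record RowCrossing (k : ℕ) (u : Index) (p : List Index) (w : Index) : Set where
  field
    before after : List Index
    j j₀         : ℕ
    split        : p ≡ before ++ after
    walk-before  : Walk u before (k , j)
    cross        : Step (k , j) (suc k , j₀)
    walk-after   : Walk (suc k , j₀) after w

crossing-here : ∀ {k j j₀ p w} → Step (k , j) (suc k , j₀) → Walk (suc k , j₀) p w →
                RowCrossing k (k , j) ((k , j) ∷ p) w
crossing-here st w = record
  { before = _ ∷ [] ; after = _ ; j = _ ; j₀ = _ ; split = refl
  ; walk-before = stop ; cross = st ; walk-after = w }

crossing-∷ : ∀ {k u v p w} → Step u v → RowCrossing k v p w → RowCrossing k u (u ∷ p) w
crossing-∷ st c = record
  { before = _ ∷ before ; after = after ; j = j ; j₀ = j₀ ; split = cong (_ ∷_) split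
  ; walk-before = step st walk-before ; cross = cross ; walk-after = walk-after }
  where open RowCrossing c

row-crossing : ∀ {i j c d p} k → i ≤ k → k < c → Walk (i , j) p (c , d) → RowCrossing k (i , j) p (c , d)
row-crossing k i≤k k<c stop = ⊥-elim (<⇒≱ k<c i≤k)
row-crossing k i≤k k<c (step right w) = crossing-∷ right (row-crossing k i≤k k<c w)
row-crossing k i≤k k<c (step up w) with m≤n⇒m<n∨m≡n i≤k
... | inj₁ i<k  = crossing-∷ up (row-crossing k i<k k<c w)
... | inj₂ refl = crossing-here up w
row-crossing k i≤k k<c (step diag w) with m≤n⇒m<n∨m≡n i≤k
... | inj₁ i<k  = crossing-∷ diag (row-crossing k i<k k<c w)
... | inj₂ refl = crossing-here diag w

IsMaxAt : ℕ → Seq → ℕ → Set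
IsMaxAt m s i = ∀ k → 1 ≤ k → k ≤ m → s k ℤ.≤ s i

maximum-attained : ∀ (s : Seq) m → ∃[ a ] 1 ≤ a × a ≤ suc m × IsMaxAt (suc m) s a
maximum-attained s zero = 1 , ≤-refl , ≤-refl , λ { .1 (s≤s z≤n) (s≤s z≤n) → ℤₚ.≤-refl }
maximum-attained s (suc m) with maximum-attained s m
... | a , 1≤a , a≤1+m , max with s a ℤ.≤? s (suc (suc m))
...   | yes sa≤ = suc (suc m) , s≤s z≤n , ≤-refl , max′
  where
  max′ : IsMaxAt (suc (suc m)) s (suc (suc m))
  max′ k 1≤k k≤ with m≤n⇒m<n∨m≡n k≤
  ... | inj₁ k< = ℤₚ.≤-trans (max k 1≤k (≤-pred k<)) sa≤
  ... | inj₂ refl = ℤₚ.≤-refl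
...   | no sa≰ = a , 1≤a , m≤n⇒m≤1+n a≤1+m , max′
  where
  max′ : IsMaxAt (suc (suc m)) s a
  max′ k 1≤k k≤ with m≤n⇒m<n∨m≡n k≤
  ... | inj₁ k< = max k 1≤k (≤-pred k<)
  ... | inj₂ refl = ℤₚ.<⇒≤ (ℤₚ.≰⇒> sa≰)

-- Otherwise the segment from a maximum to the end is monotone, or the last two entries coincide.
max-at-penultimate : ∀ m {s} → Typical (2 + m) s → IsMinAt (2 + m) s (2 + m) → IsMaxAt (2 + m) s (1 + m)
max-at-penultimate m {s} (no-repeat , no-monotone) min with maximum-attained s (suc m)
... | a , 1≤a , a≤2+m , max with <-cmp a (suc m)
...   | tri< a<1+m _ _ = ⊥-elim (no-monotone a (2 + m) 1≤a ≤-refl (s≤s (s≤s (≤-pred a<1+m))) (inj₂ descending))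
  where
  descending : BetweenDown s a (2 + m)
  descending k a≤k k≤ = max k (≤-trans 1≤a a≤k) k≤ , min k (≤-trans 1≤a a≤k) k≤
...   | tri≈ _ refl _ = max
...   | tri> _ _ a>1+m with ≤-antisym a≤2+m a>1+m
...     | refl = ⊥-elim (no-repeat (suc m) (s≤s z≤n) ≤-refl
                   (ℤₚ.≤-antisym (max (suc m) (s≤s z≤n) (n≤1+n _)) (min (suc m) (s≤s z≤n) (n≤1+n _))))

neg : Seq → Seq
neg s i = ℤ.- s i

typical-neg : ∀ {m s} → Typical m s → Typical m (neg s)
typical-neg (no-repeat , no-monotone) =
  (λ i 1≤i i<m eq → no-repeat i 1≤i i<m (ℤₚ.neg-injective eq)) ,
  (λ i j 1≤i j≤m 2+i≤j → no-monotone i j 1≤i j≤m 2+i≤j ∘ Sum.swap ∘ Sum.map up⇒down down⇒up)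
  where
  up⇒down : ∀ {s i j} → BetweenUp (neg s) i j → BetweenDown s i j
  up⇒down asc k i≤k k≤j = Product.map ℤₚ.neg-cancel-≤ ℤₚ.neg-cancel-≤ (asc k i≤k k≤j)

  down⇒up : ∀ {s i j} → BetweenDown (neg s) i j → BetweenUp s i j
  down⇒up desc k i≤k k≤j = Product.map ℤₚ.neg-cancel-≤ ℤₚ.neg-cancel-≤ (desc k i≤k k≤j)

typical-prefix : ∀ {m s} → Typical (suc m) s → Typical m s
typical-prefix (no-repeat , no-monotone) =
  (λ i 1≤i i<m → no-repeat i 1≤i (m<n⇒m<1+n i<m)) ,
  (λ i j 1≤i j≤m → no-monotone i j 1≤i (m≤n⇒m≤1+n j≤m))

min-at-antepenultimate : ∀ m {s} → Typical (3 + m) s → IsMinAt (3 + m) s (3 + m) → IsMinAt (2 + m) s (1 + m)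
min-at-antepenultimate m typical min k 1≤k k≤ =
  ℤₚ.neg-cancel-≤ (max-at-penultimate m (typical-neg (typical-prefix typical)) neg-min k 1≤k k≤)
  where
  neg-min : IsMinAt (2 + m) (neg _) (2 + m)
  neg-min k 1≤k k≤ = ℤₚ.neg-mono-≤ (max-at-penultimate (suc m) typical min k 1≤k (m≤n⇒m≤1+n k≤))

along-++ : ∀ (M : ℕ → ℕ → ℤ) p q → along M (p ++ q) ≡ along M p ++ along M q
along-++ M = Listₚ.map-++ _

module BottomChop (m′ n′ : ℕ) (r c : Seq)
  (typical-r : Typical (3 + m′) r) (typical-c : Typical (3 + n′) c)
  (min-r : IsMinAt (3 + m′) r (3 + m′)) (min-c : IsMinAt (3 + n′) c (3 + n′)) where

  private
    m n k : ℕ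
    m = 3 + m′
    n = 3 + n′
    k = 1 + m′

    M : ℕ → ℕ → ℤ
    M = merge r c

  open ℤₚ.≤-Reasoning

  corner-minimal : ∀ {v} → (1 , 1) ≼ v → v ≼ (m , n) → M m n ℤ.≤ M (proj₁ v) (proj₂ v)
  corner-minimal (1≤i , 1≤j) (i≤m , j≤n) = ℤₚ.+-mono-≤ (min-r _ 1≤i i≤m) (min-c _ 1≤j j≤n)

  row-entry-bound : ∀ {j j₀ a} → M k (2 + n′) ℤ.≤ M (suc k) (suc n′) → Step (k , j) (suc k , j₀) →
                    1 ≤ j₀ → j₀ ≤ n → j < a → a ≤ n → M k a ℤ.≤ M (suc k) j₀
  row-entry-bound {j₀ = j₀} {a} chop st 1≤j₀ j₀≤n j<a a≤n with j₀ ℕₚ.≤? 2 + n′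
  ... | yes j₀≤n-1 = begin
    r k ℤ.+ c a              ≤⟨ ℤₚ.+-monoʳ-≤ (r k) (max-at-penultimate (suc n′) typical-c min-c a (≤-trans (s≤s z≤n) j<a) a≤n) ⟩
    r k ℤ.+ c (2 + n′)       ≤⟨ chop ⟩
    r (suc k) ℤ.+ c (1 + n′) ≤⟨ ℤₚ.+-monoʳ-≤ (r (suc k)) (min-at-antepenultimate n′ typical-c min-c j₀ 1≤j₀ j₀≤n-1) ⟩
    r (suc k) ℤ.+ c j₀       ∎
  ... | no j₀≰n-1 with ≤-antisym j₀≤n (≰⇒> j₀≰n-1)
  ...   | refl with st
  ...     | up = ⊥-elim (<⇒≱ j<a a≤n)
  ...     | diag with ≤-antisym a≤n j<a
  ...       | refl = ℤₚ.+-monoˡ-≤ (c n) (max-at-penultimate (suc m′) typical-r min-r k (s≤s z≤n) (≤-trans (n≤1+n _) (n≤1+n _)))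

  chop-rows : ∀ p₁ → (∀ q → IsPathIn 1 k 1 n q → PathDominates M p₁ q) →
              M k (2 + n′) ℤ.≤ M (suc k) (suc n′) →
              ∀ q → IsPathIn 1 m 1 n q → PathDominates M (p₁ ++ (suc k , n) ∷ (m , n) ∷ []) q
  chop-rows p₁ p₁-dominates chop q q-path with row-crossing k (s≤s z≤n) (n≤1+n _) q-path
  ... | record { before = before ; j = j ; j₀ = j₀ ; split = refl
               ; walk-before = before-path ; cross = st ; walk-after = step {ps = rest} _ _ } =
    Aligned⇒Dominates (subst₂ Aligned ends-p ends-q (append-lower-bound (along M before) absorbed after-above))
    where
    after-within : All (λ v → (1 , 1) ≼ v × v ≼ (m , n)) ((suc k , j₀) ∷ rest)
    after-within = ++⁻ʳ before (walk-within q-path)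

    1≤j₀ : 1 ≤ j₀
    1≤j₀ = proj₂ (proj₁ (All.head after-within))

    j₀≤n : j₀ ≤ n
    j₀≤n = proj₂ (proj₂ (All.head after-within))

    row : ∃[ seg ] Walk (k , j) ((k , j) ∷ seg) (k , n) × All (λ v → (k , suc j) ≼ v × v ≼ (k , n)) seg
    row = rightwards (≤⇒≤‴ (≤-trans (proj₂ (step⇒≼ st)) j₀≤n))

    seg : List Index
    seg = proj₁ row

    row-below : ∀ {v} → (k , suc j) ≼ v × v ≼ (k , n) → M (proj₁ v) (proj₂ v) ℤ.≤ M (suc k) j₀
    row-below ((k≤i , j<a) , (i≤k , a≤n)) with ≤-antisym i≤k k≤i
    ... | refl = row-entry-bound chop st 1≤j₀ j₀≤n j<a a≤n

    dominated : Aligned (along M p₁) (along M before ++ along M seg)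
    dominated = subst (Aligned (along M p₁)) (along-++ M before seg)
                  (Dominates⇒Aligned (p₁-dominates _ (walk-++ before-path (proj₁ (proj₂ row)))))

    absorbed : Aligned (along M p₁ ++ M (suc k) n ∷ []) (along M before ++ M (suc k) j₀ ∷ [])
    absorbed = absorb-bounded-suffix (along M before) dominated
                 (map⁺ (All.map row-below (proj₂ (proj₂ row))))
                 (ℤₚ.+-monoʳ-≤ (r (suc k)) (min-c j₀ 1≤j₀ j₀≤n))

    after-above : All (M m n ℤ.≤_) (along M ((suc k , j₀) ∷ rest))
    after-above = map⁺ (All.map (λ (lo , hi) → corner-minimal lo hi) after-within)

    ends-p : (along M p₁ ++ M (suc k) n ∷ []) ++ M m n ∷ [] ≡ along M (p₁ ++ (suc k , n) ∷ (m , n) ∷ [])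
    ends-p = trans (Listₚ.++-assoc (along M p₁) _ _) (sym (along-++ M p₁ _))

    ends-q : along M before ++ along M ((suc k , j₀) ∷ rest) ≡ along M (before ++ (suc k , j₀) ∷ rest)
    ends-q = sym (along-++ M before _)

transpose : Index → Index
transpose (i , j) = j , i

walk-transpose : ∀ {u p w} → Walk u p w → Walk (transpose u) (map transpose p) (transpose w)
walk-transpose stop           = stop
walk-transpose (step up w)    = step right (walk-transpose w)
walk-transpose (step right w) = step up (walk-transpose w)
walk-transpose (step diag w)  = step diag (walk-transpose w)

transpose-involutive : ∀ p → map transpose (map transpose p) ≡ p
transpose-involutive p = trans (sym (Listₚ.map-∘ p)) (Listₚ.map-id p)

along-transpose : ∀ (r c : Seq) p → along (merge c r) (map transpose p) ≡ along (merge r c) p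
along-transpose r c []            = refl
along-transpose r c ((i , j) ∷ p) = cong₂ _∷_ (ℤₚ.+-comm (c j) (r i)) (along-transpose r c p)

dominates-transpose : ∀ r c {p q} → PathDominates (merge r c) p q →
                      PathDominates (merge c r) (map transpose p) (map transpose q)
dominates-transpose r c {p} {q} = subst₂ Dominates (sym (along-transpose r c p)) (sym (along-transpose r c q))

transpose-dominates : ∀ r c {p q} → PathDominates (merge c r) (map transpose p) (map transpose q) →
                      PathDominates (merge r c) p q
transpose-dominates r c {p} {q} = subst₂ Dominates (along-transpose r c p) (along-transpose r c q)

chop-columns : ∀ m′ n′ (r c : Seq) → Typical (3 + m′) r → Typical (3 + n′) c →
  IsMinAt (3 + m′) r (3 + m′) → IsMinAt (3 + n′) c (3 + n′) →
  ∀ p₂ → (∀ q → IsPathIn 1 (3 + m′) 1 (1 + n′) q → PathDominates (merge r c) p₂ q) →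
  merge r c (2 + m′) (1 + n′) ℤ.≤ merge r c (1 + m′) (2 + n′) →
  ∀ q → IsPathIn 1 (3 + m′) 1 (3 + n′) q →
  PathDominates (merge r c) (p₂ ++ (3 + m′ , 2 + n′) ∷ (3 + m′ , 3 + n′) ∷ []) q
chop-columns m′ n′ r c typical-r typical-c min-r min-c p₂ p₂-dominates chop q q-path =
  transpose-dominates r c (subst (λ p → PathDominates (merge c r) p (map transpose q))
    (sym (Listₚ.map-++ transpose p₂ _))
    (BottomChop.chop-rows n′ m′ c r typical-c typical-r min-c min-r (map transpose p₂) transposed-dominates
      (subst₂ ℤ._≤_ (ℤₚ.+-comm (r _) (c _)) (ℤₚ.+-comm (r _) (c _)) chop) (map transpose q) (walk-transpose q-path)))
  where
  transposed-dominates : ∀ q → IsPathIn 1 (1 + n′) 1 (3 + m′) q → PathDominates (merge c r) (map transpose p₂) q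
  transposed-dominates q w = subst (PathDominates (merge c r) (map transpose p₂)) (transpose-involutive q)
                               (dominates-transpose r c (p₂-dominates _ (walk-transpose w)))

lemma3p10 : (m n : ℕ) (r c : Seq) → 3 ≤ m → 3 ≤ n →
    Typical m r → Typical n c → IsMinAt m r m → IsMinAt n c n →
    (p₁ p₂ : List Index) →
    IsPathIn 1 (m ∸ 2) 1 n p₁ →
    (∀ q → IsPathIn 1 (m ∸ 2) 1 n q → PathDominates (merge r c) p₁ q) →
    IsPathIn 1 m 1 (n ∸ 2) p₂ →
    (∀ q → IsPathIn 1 m 1 (n ∸ 2) q → PathDominates (merge r c) p₂ q) →
    ((merge r c (m ∸ 2) (n ∸ 1) ℤ.≤ merge r c (m ∸ 1) (n ∸ 2) →
       ∀ q → IsPathIn 1 m 1 n q →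
         PathDominates (merge r c) (p₁ ++ ((m ∸ 1 , n) ∷ (m , n) ∷ [])) q) ×
     (merge r c (m ∸ 1) (n ∸ 2) ℤ.≤ merge r c (m ∸ 2) (n ∸ 1) →
       ∀ q → IsPathIn 1 m 1 n q →
         PathDominates (merge r c) (p₂ ++ ((m , n ∸ 1) ∷ (m , n) ∷ [])) q))
lemma3p10 _ _ r c (s≤s (s≤s (s≤s (z≤n {m′})))) (s≤s (s≤s (s≤s (z≤n {n′}))))
          typical-r typical-c min-r min-c p₁ p₂ _ p₁-dominates _ p₂-dominates =
  BottomChop.chop-rows m′ n′ r c typical-r typical-c min-r min-c p₁ p₁-dominates ,
  chop-columns m′ n′ r c typical-r typical-c min-r min-c p₂ p₂-dominates
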